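{- Let $t,\eta\ge 1$ and $\zeta\ge 2$ be integers, where $t$ divides $\zeta$. Let $G$ be a graph that does not contain $K_{t,t}$ as a subgraph, and let $(T,r)$ be a $(\zeta,\eta)$-uniform rooted tree, where $T$ is a subgraph of $G$. Then at most $\zeta^{\eta}(t-1)$ vertices in $V(G)\setminus V(T)$ are $t$-bad for $(T,r)$.
   Context: All graphs are finite, without loops or parallel edges; a subgraph need not be induced. $K_{t,t}$ is the complete bipartite graph with both parts of size $t$. A rooted tree $(H,r)$ is a tree $H$ with a distinguished vertex $r$ (the root). If $u,v\in V(H)$ are adjacent and $u$ lies on the path of $H$ between $v$ and $r$, then $v$ is a child of $u$. $(H,r)$ is $(\zeta,\eta)$-uniform if every vertex with a child has exactly $\zeta$ children, and every vertex with no child is joined to $r$ by a path of $H$ of length exactly $\eta$. For a $(\zeta,\eta)$-uniform rooted tree $(T,r)$ with $T$ a subgraph of $G$, a vertex $u\in V(G)\setminus V(T)$ is $t$-bad for $(T,r)$ if there is a vertex $w\in V(T)$ having $\zeta$ children in $(T,r)$ such that $u$ is adjacent in $G$ to more than $(t-1)\zeta/t$ of these children. -}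

module Defs where

open import Data.Nat using (ℕ; zero; suc; _*_; _∸_; _<_)
open import Data.Fin using (Fin)
open import Data.List using (List; []; _∷_; length)
open import Data.List.Membership.Propositional using (_∈_)
open import Data.List.Relation.Unary.Unique.Propositional using (Unique)
open import Data.List.Relation.Unary.All using (All)
open import Data.Product using (Σ; ∃; _×_; _,_)
open import Relation.Nullary using (¬_)
open import Relation.Binary.PropositionalEquality using (_≡_; _≢_)
open import Function.Definitions using (Injective)
open import Function.Bundles using (_⇔_)

record Graph (n : ℕ) : Set₁ where
  field
    Adj   : Fin n → Fin n → Set
    sym   : ∀ {x y} → Adj x y → Adj y x
    irrefl : ∀ {x} → ¬ Adj x x

ContainsKtt : ∀ {n} → Graph n → ℕ → Set
ContainsKtt {n} G t =
  Σ (Fin t → Fin n) λ a → Σ (Fin t → Fin n) λ b →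
    Injective _≡_ _≡_ a × Injective _≡_ _≡_ b ×
    (∀ i j → a i ≢ b j) × (∀ i j → Graph.Adj G (a i) (b j))

record Subgraph {n : ℕ} (G : Graph n) : Set₁ where
  field
    InH    : Fin n → Set
    EH     : Fin n → Fin n → Set
    EH-sym : ∀ {x y} → EH x y → EH y x
    EH-Adj : ∀ {x y} → EH x y → Graph.Adj G x y
    EH-In  : ∀ {x y} → EH x y → InH x × InH y

module _ {n : ℕ} {G : Graph n} (H : Subgraph G) where
  open Subgraph H

  data Walk : Fin n → Fin n → List (Fin n) → Set where
    single : ∀ {x} → InH x → Walk x x (x ∷ [])
    step   : ∀ {x y z p} → EH x y → Walk y z p → Walk x z (x ∷ p)

  -- A path in H from x to y (vertex list, no repeated vertices).
  -- Its length (number of edges) is  length p ∸ 1.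
  Path : Fin n → Fin n → List (Fin n) → Set
  Path x y p = Walk x y p × Unique p

  IsTree : Set
  IsTree = (∀ x y → InH x → InH y → ∃ λ p → Path x y p)
         × (∀ x y p q → Path x y p → Path x y q → p ≡ q)

  Child : Fin n → Fin n → Fin n → Set
  Child r u v = EH u v × (∀ p → Path v r p → u ∈ p)

  HasChildren : Fin n → Fin n → ℕ → Set
  HasChildren r u k = Σ (List (Fin n)) λ cs →
    length cs ≡ k × Unique cs × (∀ v → Child r u v ⇔ v ∈ cs)

  IsUniform : Fin n → ℕ → ℕ → Set
  IsUniform r ζ η =
    (∀ u → (∃ λ v → Child r u v) → HasChildren r u ζ)
    × (∀ u → InH u → (∀ v → ¬ Child r u v) →
         ∃ λ p → Path u r p × length p ∸ 1 ≡ η)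

  IsBad : Fin n → ℕ → ℕ → Fin n → Set
  IsBad r ζ t u = ¬ InH u × Σ (Fin n) λ w → HasChildren r w ζ ×
    Σ (List (Fin n)) λ L → Unique L
      × All (λ v → Child r w v × Graph.Adj G u v) L
      × (t ∸ 1) * ζ < length L * t

-- A vertex with ζ children lies at depth < η: depths increase strictly along children and
-- every leaf has depth η. Level d of the tree has at most ζ^d vertices, so there are fewer
-- than ζ^η vertices with children. Assign to each t-bad vertex u a vertex w witnessing it:
-- u misses fewer than ζ/t children of w, so t bad vertices with the same witness would have
-- at least t common neighbours among the children of w, giving a K_{t,t}. Hence every
-- witness serves at most t - 1 bad vertices.
module Submission where

open import Defs
open import Data.Nat using (ℕ; zero; suc; _+_; _*_; _∸_; _^_; _≤_; _<_; z≤n; s≤s; s≤s⁻¹; _≤?_)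
open import Data.Nat.Properties
open import Data.Nat.Tactic.RingSolver using (solve-∀)
open import Data.Nat.Divisibility using (_∣_; divides)
open import Data.Fin using (Fin; inject≤)
open import Data.Fin.Properties using (inject≤-injective) renaming (_≟_ to _≟ᶠ_)
open import Data.List using (List; []; _∷_; length; filter; map; lookup; take; deduplicate; downFrom; allFin; _++_)
open import Data.List.Properties using (length-map; length-take; length-++; length-tabulate; filter-notAll)
open import Data.Nat.ListAction using (sum)
open import Data.List.Relation.Unary.All as All using (All; []; _∷_; reduce; toList)
import Data.List.Relation.Unary.All.Properties as All
open import Data.List.Relation.Unary.AllPairs using (AllPairs; _∷_)
import Data.List.Relation.Unary.AllPairs.Properties as AllPairs
open import Data.List.Relation.Unary.Any as Any using (here; there)
open import Data.List.Relation.Unary.Unique.Propositional using (Unique)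
import Data.List.Relation.Unary.Unique.Propositional.Properties as Unique
open import Data.List.Relation.Unary.Unique.DecPropositional.Properties using (deduplicate-!)
open import Data.List.Relation.Binary.Subset.Propositional using (_⊆_)
open import Data.List.Membership.Propositional using (_∈_)
open import Data.List.Membership.Propositional.Properties
  using (∈-filter⁺; ∈-filter⁻; ∈-deduplicate⁺; ∈-deduplicate⁻; ∈-lookup; ∈-++⁻; ∈-allFin; ∈-downFrom⁺)
open import Data.Product using (Σ; ∃; _×_; _,_; proj₁; proj₂)
open import Data.Sum using (inj₁; inj₂)
open import Data.Empty using (⊥-elim)
open import Function.Bundles using (Equivalence)
open import Relation.Nullary using (¬_; yes; no; ¬?)
open import Relation.Nullary.Decidable using (decidable-stable; ¬¬-excluded-middle)
open import Relation.Unary using (Decidable)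
open import Relation.Binary.Definitions using (DecidableEquality)
open import Relation.Binary.PropositionalEquality using (_≡_; _≢_; refl; sym; trans; cong; subst)

module _ {a} {A : Set a} where

  lookup-injective : ∀ {xs : List A} → Unique xs → ∀ {i j} → lookup xs i ≡ lookup xs j → i ≡ j
  lookup-injective {_ ∷ _} (x∉ ∷ u) {Fin.zero}  {Fin.zero}  eq = refl
  lookup-injective {_ ∷ _} (x∉ ∷ u) {Fin.zero}  {Fin.suc j} eq = ⊥-elim (All.lookup x∉ (∈-lookup j) eq)
  lookup-injective {_ ∷ _} (x∉ ∷ u) {Fin.suc i} {Fin.zero}  eq = ⊥-elim (All.lookup x∉ (∈-lookup i) (sym eq))
  lookup-injective {_ ∷ _} (x∉ ∷ u) {Fin.suc i} {Fin.suc j} eq = cong Fin.suc (lookup-injective u eq)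

  length-filter+length-filter-∁ : ∀ {p} {P : A → Set p} (P? : Decidable P) xs →
    length xs ≡ length (filter P? xs) + length (filter (λ x → ¬? (P? x)) xs)
  length-filter+length-filter-∁ P? [] = refl
  length-filter+length-filter-∁ P? (x ∷ xs) with P? x
  ... | yes _ = cong suc (length-filter+length-filter-∁ P? xs)
  ... | no  _ = trans (cong suc (length-filter+length-filter-∁ P? xs)) (sym (+-suc _ _))

module _ {a} {A : Set a} (_≟_ : DecidableEquality A) where
  open import Data.List.Membership.DecPropositional _≟_ using (_∈?_)

  Unique-⊆⇒length≤ : ∀ {xs ys : List A} → Unique xs → xs ⊆ ys → length xs ≤ length ys
  Unique-⊆⇒length≤ {[]}     _        _   = z≤n
  Unique-⊆⇒length≤ {x ∷ xs} {ys} (x∉ ∷ u) sub = ≤-trans (s≤s (Unique-⊆⇒length≤ u xs⊆ys-x)) ys-x<ys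
    where
    ys-x = filter (λ y → ¬? (x ≟ y)) ys
    ys-x<ys : length ys-x < length ys
    ys-x<ys = filter-notAll (λ y → ¬? (x ≟ y)) ys (Any.map (λ eq ne → ne eq) (sub (here refl)))
    xs⊆ys-x : xs ⊆ ys-x
    xs⊆ys-x y∈ = ∈-filter⁺ (λ y → ¬? (x ≟ y)) (sub (there y∈)) (All.lookup x∉ y∈)

  common : List (List A) → List A → List A
  common []       xs = xs
  common (L ∷ Ls) xs = filter (_∈? L) (common Ls xs)

  ∈-common⁻ : ∀ Ls {xs x} → x ∈ common Ls xs → x ∈ xs × All (x ∈_) Ls
  ∈-common⁻ []       x∈ = x∈ , []
  ∈-common⁻ (L ∷ Ls) x∈ with ∈-filter⁻ (_∈? L) x∈
  ... | x∈C , x∈L with ∈-common⁻ Ls x∈C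
  ... | x∈xs , x∈Ls = x∈xs , x∈L ∷ x∈Ls

  common-Unique : ∀ Ls {xs} → Unique xs → Unique (common Ls xs)
  common-Unique []       u = u
  common-Unique (L ∷ Ls) u = Unique.filter⁺ (_∈? L) (common-Unique Ls u)

  -- Each L misses at most m elements of xs, so together they miss at most (length Ls) * m.
  length-common : ∀ {m xs} → Unique xs → ∀ Ls →
    All (λ L → Unique L × L ⊆ xs × length xs ≤ length L + m) Ls →
    length xs ≤ length (common Ls xs) + length Ls * m
  length-common u [] [] = ≤-reflexive (sym (+-identityʳ _))
  length-common {m} {xs} u (L ∷ Ls) ((uL , L⊆xs , xs≤L+m) ∷ hyps) = begin
    length xs                            ≤⟨ length-common u Ls hyps ⟩
    length C + length Ls * m             ≡⟨ cong (_+ length Ls * m) (length-filter+length-filter-∁ (_∈? L) C) ⟩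
    length F + length N + length Ls * m  ≤⟨ +-monoˡ-≤ (length Ls * m) (+-monoʳ-≤ (length F) N≤m) ⟩
    length F + m + length Ls * m         ≡⟨ +-assoc (length F) m (length Ls * m) ⟩
    length F + (m + length Ls * m)       ∎
    where
    open ≤-Reasoning
    C = common Ls xs
    F = filter (_∈? L) C
    N = filter (λ x → ¬? (x ∈? L)) C
    N⊆xs : N ⊆ xs
    N⊆xs x∈N = proj₁ (∈-common⁻ Ls (proj₁ (∈-filter⁻ (λ x → ¬? (x ∈? L)) {xs = C} x∈N)))
    N++L⊆xs : N ++ L ⊆ xs
    N++L⊆xs x∈ with ∈-++⁻ N x∈
    ... | inj₁ x∈N = N⊆xs x∈N
    ... | inj₂ x∈L = L⊆xs x∈L
    N++L-Unique : Unique (N ++ L)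
    N++L-Unique = Unique.++⁺ (Unique.filter⁺ (λ x → ¬? (x ∈? L)) (common-Unique Ls u)) uL
      (λ (x∈N , x∈L) → proj₂ (∈-filter⁻ (λ x → ¬? (x ∈? L)) {xs = C} x∈N) x∈L)
    N≤m : length N ≤ m
    N≤m = +-cancelʳ-≤ (length L) (length N) m (begin
      length N + length L  ≡⟨ sym (length-++ N) ⟩
      length (N ++ L)      ≤⟨ Unique-⊆⇒length≤ N++L-Unique N++L⊆xs ⟩
      length xs            ≤⟨ xs≤L+m ⟩
      length L + m         ≡⟨ +-comm (length L) m ⟩
      m + length L         ∎)

sum-map-const : ∀ {a} {A : Set a} c (xs : List A) → sum (map (λ _ → c) xs) ≡ length xs * c
sum-map-const c []       = refl
sum-map-const c (x ∷ xs) = cong (c +_) (sum-map-const c xs)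

module _ {a p} {A : Set a} {P : A → Set p} where

  map-proj₁-toList : ∀ {xs} (pxs : All P xs) → map proj₁ (toList pxs) ≡ xs
  map-proj₁-toList []         = refl
  map-proj₁-toList (px ∷ pxs) = cong (_ ∷_) (map-proj₁-toList pxs)

  length-reduce : ∀ {b} {B : Set b} (f : ∀ {x} → P x → B) {xs} (pxs : All P xs) → length (reduce f pxs) ≡ length xs
  length-reduce f []         = refl
  length-reduce f (px ∷ pxs) = cong suc (length-reduce f pxs)

module _ {a k r} {A : Set a} {K : Set k} (_≟_ : DecidableEquality K) (R : A → K → Set r) where

  count-by-fibres : (bound : K → ℕ) (Y : List K) →
    (∀ {y} → y ∈ Y → ∀ {zs} → Unique zs → All (λ z → R z y) zs → length zs ≤ bound y) →
    ∀ {xs} → Unique xs → All (λ x → ∃ λ y → y ∈ Y × R x y) xs → length xs ≤ sum (map bound Y)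
  count-by-fibres bound Y fibre {xs} u keyed =
    subst (_≤ sum (map bound Y)) length-keyed
      (count Y fibre (AllPairs.map⁻ (subst Unique (sym (map-proj₁-toList keyed)) u))
                     (All.tabulate (λ { {_ , _ , y∈ , _} _ → y∈ })))
    where
    Keyed = ∃ λ x → ∃ λ y → y ∈ Y × R x y
    key : Keyed → K
    key (_ , y , _) = y
    length-keyed : length (toList keyed) ≡ length xs
    length-keyed = trans (sym (length-map proj₁ (toList keyed))) (cong length (map-proj₁-toList keyed))
    count : ∀ Y′ → (∀ {y} → y ∈ Y′ → ∀ {zs} → Unique zs → All (λ z → R z y) zs → length zs ≤ bound y) →
      ∀ {zs : List Keyed} → AllPairs (λ z z′ → proj₁ z ≢ proj₁ z′) zs → All (λ z → key z ∈ Y′) zs →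
      length zs ≤ sum (map bound Y′)
    count []       _      _  []         = z≤n
    count []       _      _  (() ∷ _)
    count (y ∷ Y′) fibre′ {zs} ap keys∈ = begin
      length zs                        ≡⟨ length-filter+length-filter-∁ at-y? zs ⟩
      length here-y + length elsewhere ≤⟨ +-mono-≤ here-y≤ elsewhere≤ ⟩
      bound y + sum (map bound Y′)      ∎
      where
      open ≤-Reasoning
      at-y? = λ z → key z ≟ y
      here-y = filter at-y? zs
      elsewhere = filter (λ z → ¬? (at-y? z)) zs
      here-y≤ : length here-y ≤ bound y
      here-y≤ = subst (_≤ bound y) (length-map proj₁ here-y)
        (fibre′ (here refl) (AllPairs.map⁺ (AllPairs.filter⁺ at-y? ap))
          (All.map⁺ (All.map (λ { {_ , _ , _ , rel} refl → rel }) (All.all-filter at-y? zs))))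
      elsewhere≤ : length elsewhere ≤ sum (map bound Y′)
      elsewhere≤ = count Y′ (λ y∈ → fibre′ (there y∈)) (AllPairs.filter⁺ (λ z → ¬? (at-y? z)) ap)
        (All.tabulate λ {z} z∈ → let (z∈zs , z≢y) = ∈-filter⁻ (λ z → ¬? (at-y? z)) {xs = zs} z∈ in
          case-∈ {z} z≢y (All.lookup keys∈ z∈zs))
        where
        case-∈ : ∀ {z} → key z ≢ y → key z ∈ y ∷ Y′ → key z ∈ Y′
        case-∈ z≢y (here eq) = ⊥-elim (z≢y eq)
        case-∈ z≢y (there z∈) = z∈

  count-by-bounded-fibres : ∀ {p} (P : K → Set p) (c : ℕ) →
    (∀ {y} → P y → ∀ {zs} → Unique zs → All (λ z → R z y) zs → length zs ≤ c) →
    ∀ {xs} → Unique xs → All (λ x → ∃ λ y → P y × R x y) xs →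
    ∃ λ Y → Unique Y × All P Y × length xs ≤ length Y * c
  count-by-bounded-fibres P c fibre {xs} u keyed =
    Y , deduplicate-! _≟_ keys , Y-P ,
    subst (length xs ≤_) (sum-map-const c Y)
      (count-by-fibres (λ _ → c) Y (λ y∈ → fibre (All.lookup Y-P y∈)) u
        (All.map (λ (y , y∈ , rel) → y , ∈-deduplicate⁺ _≟_ y∈ , rel) (keyed-in-keys keyed)))
    where
    keys = reduce proj₁ keyed
    Y = deduplicate _≟_ keys
    keys-P : ∀ {xs} (keyed : All (λ x → ∃ λ y → P y × R x y) xs) → All P (reduce proj₁ keyed)
    keys-P []                     = []
    keys-P ((_ , py , _) ∷ keyed) = py ∷ keys-P keyed
    Y-P : All P Y
    Y-P = All.tabulate (λ y∈ → All.lookup (keys-P keyed) (∈-deduplicate⁻ _≟_ keys y∈))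
    keyed-in-keys : ∀ {xs} (keyed : All (λ x → ∃ λ y → P y × R x y) xs) →
      All (λ x → ∃ λ y → y ∈ reduce proj₁ keyed × R x y) xs
    keyed-in-keys []                      = []
    keyed-in-keys ((y , _ , rel) ∷ keyed) =
      (y , here refl , rel) ∷ All.map (λ (y′ , y′∈ , rel′) → y′ , there y′∈ , rel′) (keyed-in-keys keyed)

sum-powers-downFrom< : ∀ {ζ} → 2 ≤ ζ → ∀ k → sum (map (ζ ^_) (downFrom k)) < ζ ^ k
sum-powers-downFrom< ζ≥2 zero    = ≤-refl
sum-powers-downFrom< {ζ} ζ≥2 (suc k) = begin-strict
  ζ ^ k + sum (map (ζ ^_) (downFrom k)) <⟨ +-monoʳ-< (ζ ^ k) (sum-powers-downFrom< ζ≥2 k) ⟩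
  ζ ^ k + ζ ^ k                         ≡⟨ cong (ζ ^ k +_) (sym (+-identityʳ (ζ ^ k))) ⟩
  2 * ζ ^ k                             ≤⟨ *-monoˡ-≤ (ζ ^ k) ζ≥2 ⟩
  ζ * ζ ^ k                             ∎
  where open ≤-Reasoning

-- With t = s + 1 and ζ = (m + 1) t: if ℓ t > (t - 1) ζ then ℓ misses at most m of ζ.
*-threshold⇒≤+ : ∀ m s ℓ → s * (suc m * suc s) < ℓ * suc s → suc m * suc s ≤ ℓ + m
*-threshold⇒≤+ m s ℓ s*ζ<ℓ*t = begin
  suc m * suc s       ≡⟨ expand m s ⟩
  suc (s * suc m) + m ≤⟨ +-monoˡ-≤ m (*-cancelʳ-< (suc s) (s * suc m) ℓ (subst (_< ℓ * suc s) (reassociate m s) s*ζ<ℓ*t)) ⟩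
  ℓ + m               ∎
  where
  open ≤-Reasoning
  expand : ∀ m s → suc m * suc s ≡ suc (s * suc m) + m
  expand = solve-∀
  reassociate : ∀ m s → s * (suc m * suc s) ≡ s * suc m * suc s
  reassociate = solve-∀

module _ {n} (G : Graph n) where

  ContainsKtt-from-lists : ∀ {t} {X Y : List (Fin n)} → Unique X → Unique Y → t ≤ length X → t ≤ length Y →
    (∀ {x y} → x ∈ X → y ∈ Y → x ≢ y × Graph.Adj G x y) → ContainsKtt G t
  ContainsKtt-from-lists {X = X} {Y} uX uY t≤X t≤Y complete =
    a , b , a-injective , b-injective ,
    (λ i j → proj₁ (complete (∈-lookup _) (∈-lookup _))) , (λ i j → proj₂ (complete (∈-lookup _) (∈-lookup _)))
    where
    a = λ i → lookup X (inject≤ i t≤X)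
    b = λ j → lookup Y (inject≤ j t≤Y)
    a-injective : ∀ {i j} → a i ≡ a j → i ≡ j
    a-injective eq = inject≤-injective t≤X t≤X _ _ (lookup-injective uX eq)
    b-injective : ∀ {i j} → b i ≡ b j → i ≡ j
    b-injective eq = inject≤-injective t≤Y t≤Y _ _ (lookup-injective uY eq)

module UniformTree {n} {G : Graph n} (T : Subgraph G) (r : Fin n) (r∈T : Subgraph.InH T r)
  (tree : IsTree T) {ζ η : ℕ} (uniform : IsUniform T r ζ η) where
  open Subgraph T

  -- The path of T from x to r has d edges, i.e. d + 1 vertices.
  AtDepth : ℕ → Fin n → Set
  AtDepth d x = ∃ λ p → Path T x r p × length p ≡ suc d

  Path-unique : ∀ {x y p q} → Path T x y p → Path T x y q → p ≡ q
  Path-unique = proj₂ tree _ _ _ _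

  Walk-head∈ : ∀ {x y p} → Walk T x y p → x ∈ p
  Walk-head∈ (single _) = here refl
  Walk-head∈ (step _ _) = here refl

  Walk-InH : ∀ {x y p} → Walk T x y p → InH x
  Walk-InH (single x∈T) = x∈T
  Walk-InH (step xy _)  = proj₁ (EH-In xy)

  Path-length≤ : ∀ {x y p} → Path T x y p → length p ≤ n
  Path-length≤ {p = p} (_ , u) = subst (length p ≤_) (length-tabulate (λ i → i))
    (Unique-⊆⇒length≤ _≟ᶠ_ u (λ {x} _ → ∈-allFin x))

  Path-suffix : ∀ {x y z p} → Path T x z p → y ∈ p → ∃ λ s → Path T y z s × length s ≤ length p
  Path-suffix path@(single _ , _) (here refl) = _ , path , ≤-refl
  Path-suffix path@(step _ _ , _) (here refl) = _ , path , ≤-refl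
  Path-suffix (single _ , _) (there ())
  Path-suffix (step _ w , _ ∷ u) (there y∈) =
    let (s , s-path , s≤) = Path-suffix (w , u) y∈ in s , s-path , m≤n⇒m≤1+n s≤

  Path-strict-suffix : ∀ {x y z p} → Path T x z p → y ∈ p → y ≢ x → ∃ λ s → Path T y z s × length s < length p
  Path-strict-suffix (single _ , _) (here refl) y≢x = ⊥-elim (y≢x refl)
  Path-strict-suffix (step _ _ , _) (here refl) y≢x = ⊥-elim (y≢x refl)
  Path-strict-suffix (single _ , _) (there ()) _
  Path-strict-suffix (step _ w , _ ∷ u) (there y∈) _ =
    let (s , s-path , s≤) = Path-suffix (w , u) y∈ in s , s-path , s≤s s≤

  depth-exists : ∀ {x} → InH x → ∃ λ d → AtDepth d x
  depth-exists x∈T with proj₁ tree _ r x∈T r∈T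
  ... | _ , path@(single _ , _) = 0 , _ , path , refl
  ... | _ , path@(step _ _ , _) = _ , _ , path , refl

  AtDepth-zero⇒root : ∀ {x} → AtDepth 0 x → x ≡ r
  AtDepth-zero⇒root (_ , (single _ , _) , _)          = refl
  AtDepth-zero⇒root (_ , (step _ (single _) , _) , ())
  AtDepth-zero⇒root (_ , (step _ (step _ _) , _) , ())

  parent : ∀ {d x} → AtDepth (suc d) x → ∃ λ y → AtDepth d y × Child T r y x
  parent (_ , (single _ , _) , ())
  parent (_ , path@(step {y = y} xy w , _ ∷ u) , len) =
    y , (_ , (w , u) , suc-injective len) ,
    EH-sym xy , λ q q-path → subst (y ∈_) (Path-unique path q-path) (there (Walk-head∈ w))

  child-deeper : ∀ {d x c} → AtDepth d x → Child T r x c → ∃ λ e → AtDepth e c × d < e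
  child-deeper {d} (p , p-path , len-p) (xc , x-on-paths) with depth-exists (proj₂ (EH-In xc))
  ... | e , q , q-path , len-q
      with Path-strict-suffix q-path (x-on-paths q q-path) (λ { refl → Graph.irrefl G (EH-Adj xc) })
  ...   | s , s-path , s<q with Path-unique s-path p-path
  ...     | refl = e , (q , q-path , len-q) , s≤s⁻¹ (subst (_≤ suc e) (cong suc len-p) (subst (suc (length s) ≤_) len-q s<q))

  -- Depths strictly increase along children and are bounded by n, and a vertex without
  -- children has depth η; the double negation is removed since ≤ is decidable.
  AtDepth⇒≤height : ∀ {d x} → AtDepth d x → d ≤ η
  AtDepth⇒≤height {d} at = decidable-stable (d ≤? η) (descend n at (m≤n+m n d))
    where
    descend : ∀ fuel {d x} → AtDepth d x → n ≤ d + fuel → ¬ ¬ (d ≤ η)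
    descend zero {d} (p , p-path , len) n≤d+0 _ =
      n≮n d (≤-trans (subst (_≤ n) len (Path-length≤ p-path)) (subst (n ≤_) (+-identityʳ d) n≤d+0))
    descend (suc fuel) {d} {x} at@(p , p-path , len) n≤ d≰η = ¬¬-excluded-middle {A = ∃ (Child T r x)} λ where
      (yes (c , x→c)) →
        let (e , at′ , d<e) = child-deeper at x→c in
        descend fuel at′ (≤-trans n≤ (≤-trans (≤-reflexive (+-suc d fuel)) (+-monoˡ-≤ fuel d<e)))
          (λ e≤η → d≰η (≤-trans (<⇒≤ d<e) e≤η))
      (no childless) →
        let (q , q-path , len-q) = proj₂ uniform x (Walk-InH (proj₁ p-path)) (λ c x→c → childless (c , x→c)) in
        d≰η (≤-reflexive (trans (sym (cong (_∸ 1) (trans (cong length (Path-unique q-path p-path)) len))) len-q))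

  children-≤ : ∀ {y zs} → Unique zs → All (Child T r y) zs → length zs ≤ ζ
  children-≤ {zs = []} _ _ = z≤n
  children-≤ {y} {z ∷ zs} u children@(y→z ∷ _) with proj₁ uniform y (z , y→z)
  ... | cs , len , _ , children⇔ = subst (length (z ∷ zs) ≤_) len
    (Unique-⊆⇒length≤ _≟ᶠ_ u (λ {v} v∈ → Equivalence.to (children⇔ v) (All.lookup children v∈)))

  level-size : ∀ d {X} → Unique X → All (AtDepth d) X → length X ≤ ζ ^ d
  level-size zero u at = Unique-⊆⇒length≤ _≟ᶠ_ {ys = r ∷ []} u (λ x∈ → here (AtDepth-zero⇒root (All.lookup at x∈)))
  level-size (suc d) {X} u at
    with count-by-bounded-fibres _≟ᶠ_ (λ x y → Child T r y x) (AtDepth d) ζ (λ _ → children-≤) u (All.map parent at)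
  ... | Y , uY , atY , X≤Y*ζ = begin
    length X      ≤⟨ X≤Y*ζ ⟩
    length Y * ζ  ≤⟨ *-monoˡ-≤ ζ (level-size d uY atY) ⟩
    ζ ^ d * ζ     ≡⟨ *-comm (ζ ^ d) ζ ⟩
    ζ ^ suc d     ∎
    where open ≤-Reasoning

  HasChildren⇒depth< : ∀ {w} → 1 ≤ ζ → HasChildren T r w ζ → ∃ λ d → AtDepth d w × d < η
  HasChildren⇒depth< ζ≥1 ([] , len , _) = ⊥-elim (n≮n 0 (subst (1 ≤_) (sym len) ζ≥1))
  HasChildren⇒depth< ζ≥1 (c ∷ _ , _ , _ , children⇔) =
    let w→c = Equivalence.from (children⇔ c) (here refl)
        (d , at) = depth-exists (proj₁ (EH-In (proj₁ w→c)))
        (e , at′ , d<e) = child-deeper at w→c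
    in d , at , <-≤-trans d<e (AtDepth⇒≤height at′)

  internal-vertices-count : 1 ≤ ζ → ∀ {W} → Unique W → All (λ w → HasChildren T r w ζ) W →
    length W ≤ sum (map (ζ ^_) (downFrom η))
  internal-vertices-count ζ≥1 u internal =
    count-by-fibres _≟_ (λ w d → AtDepth d w) (ζ ^_) (downFrom η) (λ {d} _ → level-size d) u
      (All.map (λ w-internal → let (d , at , d<η) = HasChildren⇒depth< ζ≥1 w-internal in d , ∈-downFrom⁺ d<η , at)
               internal)

-- Here t = suc s and ζ = (m + 1) t, so that a t-bad vertex misses at most m of the ζ children.
module BadVertices {n} {G : Graph n} (T : Subgraph G) (r : Fin n) (s m : ℕ) where
  open Subgraph T

  private
    t ζ : ℕ
    t = suc s
    ζ = suc m * t

  BadVia : Fin n → Fin n → Set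
  BadVia w u = ¬ InH u × Σ (List (Fin n)) λ L →
    Unique L × All (λ v → Child T r w v × Graph.Adj G u v) L × (t ∸ 1) * ζ < length L * t

  IsBad⇒BadVia : ∀ {u} → IsBad T r ζ t u → ∃ λ w → HasChildren T r w ζ × BadVia w u
  IsBad⇒BadVia (u∉T , w , w-children , L-witness) = w , w-children , u∉T , L-witness

  neighbours : ∀ {w u} → BadVia w u → List (Fin n)
  neighbours (_ , L , _) = L

  -- t vertices bad via w would have at least t common neighbours among the children of w.
  BadVia-fibre : ¬ ContainsKtt G t → ∀ {w} → HasChildren T r w ζ →
    ∀ {zs} → Unique zs → All (BadVia w) zs → length zs ≤ s
  BadVia-fibre no-Ktt {w} (cs , len-cs , cs-unique , children⇔) {zs} u bad with length zs ≤? s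
  ... | yes zs≤s = zs≤s
  ... | no  zs≰s = ⊥-elim (no-Ktt (ContainsKtt-from-lists G (Unique.take⁺ t u) (common-Unique _≟ᶠ_ Ls cs-unique)
                                     (≤-reflexive (sym length-zs′)) t≤C complete))
    where
    zs′ = take t zs
    bad′ = All.take⁺ t bad
    Ls = reduce neighbours bad′
    C = common _≟ᶠ_ Ls cs
    length-zs′ : length zs′ ≡ t
    length-zs′ = trans (length-take t zs) (m≤n⇒m⊓n≡m (≰⇒> zs≰s))
    neighbours-in-cs : ∀ {xs} (bad : All (BadVia w) xs) →
      All (λ L → Unique L × L ⊆ cs × length cs ≤ length L + m) (reduce neighbours bad)
    neighbours-in-cs [] = []
    neighbours-in-cs ((_ , L , L-unique , L-adjacent , many) ∷ bad) =
      (L-unique , (λ {v} v∈ → Equivalence.to (children⇔ v) (proj₁ (All.lookup L-adjacent v∈))) ,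
       subst (_≤ length L + m) (sym len-cs) (*-threshold⇒≤+ m s (length L) many)) ∷ neighbours-in-cs bad
    adjacent : ∀ {xs} (bad : All (BadVia w) xs) {y} → All (y ∈_) (reduce neighbours bad) →
      All (λ x → Graph.Adj G x y) xs
    adjacent [] [] = []
    adjacent ((_ , _ , _ , L-adjacent , _) ∷ bad) (y∈L ∷ y∈Ls) = proj₂ (All.lookup L-adjacent y∈L) ∷ adjacent bad y∈Ls
    t≤C : t ≤ length C
    t≤C = +-cancelʳ-≤ (m * t) t (length C) (begin
      ζ                     ≡⟨ sym len-cs ⟩
      length cs             ≤⟨ length-common _≟ᶠ_ cs-unique Ls (neighbours-in-cs bad′) ⟩
      length C + length Ls * m ≡⟨ cong (λ k → length C + k * m) (trans (length-reduce neighbours bad′) length-zs′) ⟩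
      length C + t * m      ≡⟨ cong (length C +_) (*-comm t m) ⟩
      length C + m * t      ∎)
      where open ≤-Reasoning
    complete : ∀ {x y} → x ∈ zs′ → y ∈ C → x ≢ y × Graph.Adj G x y
    complete x∈ y∈ =
      let (y∈cs , y∈Ls) = ∈-common⁻ _≟ᶠ_ Ls y∈
          y∈T = proj₂ (EH-In (proj₁ (Equivalence.from (children⇔ _) y∈cs)))
      in (λ { refl → proj₁ (All.lookup bad′ x∈) y∈T }) , All.lookup (adjacent bad′ y∈Ls) x∈

mainTheorem3 : (t η ζ : ℕ) → 1 ≤ t → 1 ≤ η → 2 ≤ ζ → t ∣ ζ →
    {n : ℕ} (G : Graph n) → ¬ ContainsKtt G t →
    (T : Subgraph G) (r : Fin n) → Subgraph.InH T r →
    IsTree T → IsUniform T r ζ η →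
    (B : List (Fin n)) → Unique B → All (IsBad T r ζ t) B →
    length B ≤ ζ ^ η * (t ∸ 1)
mainTheorem3 zero    _ _ ()
mainTheorem3 (suc s) _ _ _ _ () (divides zero refl)
mainTheorem3 (suc s) η .(suc m * suc s) _ _ ζ≥2 (divides (suc m) refl) G no-Ktt T r r∈T tree uniform B B-unique B-bad =
  let (W , W-unique , W-internal , B≤W*s) =
        count-by-bounded-fibres _≟ᶠ_ (λ u w → BadVia w u) (λ w → HasChildren T r w (suc m * suc s)) s (BadVia-fibre no-Ktt)
          B-unique (All.map IsBad⇒BadVia B-bad)
      W<ζ^η = ≤-<-trans (internal-vertices-count (≤-trans (s≤s z≤n) ζ≥2) W-unique W-internal)
                        (sum-powers-downFrom< ζ≥2 η)
  in ≤-trans B≤W*s (*-monoˡ-≤ s (<⇒≤ W<ζ^η))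
  where
  open BadVertices T r s m
  open UniformTree T r r∈T tree uniform
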